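{- Let $(W_r)_{r\in\mathbb{Z}}$ be a generalized Tribonacci sequence and $(T_r)_{r\in\mathbb{Z}}$ the Tribonacci sequence. For all integers $r$ and $s$: \[ \begin{split} 16W_{r+s}^2 &= -(T_{s}+T_{s+4})(-T_{s+4}+2T_{s-1}+7T_{s})W_{r}^2+4T_{s-1}T_{s}W_{r-7}^2\\ &\quad+2T_{s-1}(-T_{s+4}-9T_{s}+2T_{s-1})W_{r-4}^2-2T_{s}(T_{s+4}-7T_{s}+2T_{s-1})W_{r-3}^2\\ &\quad+8T_{s-1}(T_{s}+T_{s+4})W_{r-1}^2+2T_{s}(T_{s}+T_{s+4})W_{r+1}^2, \end{split} \] \[ \begin{split} 16W_{r+s}^2 &= 4(2T_{s}-T_{s+1})(7T_{s}-T_{s-4}-4T_{s+1})W_{r}^2+4T_{s-4}(2T_{s}-T_{s+1})W_{r-4}^2\\ &\quad-4T_{s-4}(-T_{s-4}-4T_{s+1}+9T_{s})W_{r-1}^2+16T_{s-4}T_{s}W_{r+2}^2\\ &\quad-4T_{s}(7T_{s}+T_{s-4}-4T_{s+1})W_{r+3}^2+4T_{s}(2T_{s}-T_{s+1})W_{r+4}^2, \end{split} \] \[ \begin{split} 4W_{r+s}^2 &= -2(-T_{s+1}+T_{s})(2T_{s+2}-T_{s-1})W_{r}^2-T_{s-1}T_{s}W_{r-5}^2\\ &\quad+2T_{s-1}(-T_{s+1}+T_{s})W_{r-4}^2+2T_{s}(-T_{s+1}+T_{s})W_{r-3}^2\\ &\quad+4T_{s-1}T_{s}W_{r-2}^2+2T_{s-1}(2T_{s-1}+4T_{s+1}-3T_{s})W_{r-1}^2\\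 &\quad+2T_{s}(T_{s}+T_{s+1})W_{r+1}^2-T_{s-1}T_{s}W_{r+3}^2+4T_{s-1}T_{s}W_{r+2}^2. \end{split} \]
   Context: Let $W_0,W_1,W_2$ be arbitrary integers, not all zero. The generalized Tribonacci numbers $(W_r)_{r\in\mathbb{Z}}$ are defined by $W_r=W_{r-1}+W_{r-2}+W_{r-3}$ for $r\ge 3$, and extended to negative indices by $W_{ -r}=W_{ -r+3}-W_{ -r+2}-W_{ -r+1}$ (so the recurrence holds for all $r\in\mathbb{Z}$). The Tribonacci numbers $(T_r)_{r\in\mathbb{Z}}$ are the special case $T_0=0$, $T_1=T_2=1$. -}

module Defs where

open import Data.Nat using (ℕ; zero; suc)
open import Data.Integer using (ℤ; +_; -[1+_]; _+_; _-_; _*_; -_)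
open import Data.Product using (_×_; _,_; proj₁)

-- triple (W_n, W_{n+1}, W_{n+2})
private
  fwd : ℤ × ℤ × ℤ → ℤ × ℤ × ℤ
  fwd (a , b , c) = (b , c , a + b + c)

  bwd : ℤ × ℤ × ℤ → ℤ × ℤ × ℤ
  bwd (a , b , c) = (c - b - a , a , b)

  iter : (ℤ × ℤ × ℤ → ℤ × ℤ × ℤ) → ℕ → ℤ × ℤ × ℤ → ℤ × ℤ × ℤ
  iter f zero t = t
  iter f (suc n) t = f (iter f n t)

-- Generalized Tribonacci numbers with initial values W₀ W₁ W₂, indexed by ℤ:
-- W r = W(r-1) + W(r-2) + W(r-3) for all r ∈ ℤ.
W : ℤ → ℤ → ℤ → ℤ → ℤ
W w0 w1 w2 (+ n)     = proj₁ (iter fwd n (w0 , w1 , w2))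
W w0 w1 w2 -[1+ n ]  = proj₁ (iter bwd (suc n) (w0 , w1 , w2))

T : ℤ → ℤ
T = W (+ 0) (+ 1) (+ 1)

-- A sequence satisfying the Tribonacci recurrence on all of ℤ is determined by three
-- consecutive values.  Since s ↦ v r T(s-2) + v(r+1) T(s) + (v(r+2) - v(r+1)) T(s-1)
-- satisfies the recurrence and agrees with s ↦ v(r+s) at s = 0, 1, 2, the two coincide.
-- Expanding in this way every shifted W around the window (W r, W(r+1), W(r+2)), and every
-- shifted T around (T s, T(s+1), T(s+2)), turns each identity into a polynomial identity in
-- these six values.
module Submission where

open import Defs
open import Data.Nat using (suc)
open import Data.Integer using (ℤ; +_; -[1+_]; _+_; _-_; _*_; -_)
open import Data.Integer.Properties using (+-assoc; +-identityʳ)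
open import Data.Integer.Tactic.RingSolver using (solve-∀; solve)
open import Data.List using (_∷_; [])
open import Data.Product using (_×_; _,_)
open import Relation.Binary.PropositionalEquality
open import Relation.Nullary using (¬_)

-- A record rather than a bare Π-type, so that v can be inferred from a proof of Tribonacci v.
record Tribonacci (v : ℤ → ℤ) : Set where
  constructor tribonacci
  field recurrence : ∀ n → v (+ 3 + n) ≡ v n + v (+ 1 + n) + v (+ 2 + n)

open Tribonacci

i≡i-j-k+k+j : ∀ i j k → i ≡ (i - j - k) + k + j
i≡i-j-k+k+j = solve-∀

-- The negative cases are split only far enough for the index arithmetic to compute.
W-tribonacci : ∀ w₀ w₁ w₂ → Tribonacci (W w₀ w₁ w₂)
W-tribonacci w₀ w₁ w₂ = tribonacci λ where
  (+ m)                      → refl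
  -[1+ 0 ]                   → i≡i-j-k+k+j _ _ _
  -[1+ 1 ]                   → i≡i-j-k+k+j _ _ _
  -[1+ 2 ]                   → i≡i-j-k+k+j _ _ _
  -[1+ suc (suc (suc m)) ]   → i≡i-j-k+k+j _ _ _

T-tribonacci : Tribonacci T
T-tribonacci = W-tribonacci (+ 0) (+ 1) (+ 1)

module _ {u v : ℤ → ℤ} (tu : Tribonacci u) (tv : Tribonacci v) where

  Tribonacci-+ : Tribonacci (λ n → u n + v n)
  Tribonacci-+ = tribonacci λ n →
    trans (cong₂ _+_ (recurrence tu n) (recurrence tv n))
          (interchange (u n) (u (+ 1 + n)) (u (+ 2 + n)) (v n) (v (+ 1 + n)) (v (+ 2 + n)))
    where
    interchange : ∀ a b c d e f → (a + b + c) + (d + e + f) ≡ (a + d) + (b + e) + (c + f)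
    interchange = solve-∀

  private
    Agree : ℤ → Set
    Agree n = u n ≡ v n

    agree-up : ∀ n → Agree n → Agree (+ 1 + n) → Agree (+ 2 + n) → Agree (+ 3 + n)
    agree-up n p q r = begin
      u (+ 3 + n)                          ≡⟨ recurrence tu n ⟩
      u n + u (+ 1 + n) + u (+ 2 + n)      ≡⟨ cong₂ _+_ (cong₂ _+_ p q) r ⟩
      v n + v (+ 1 + n) + v (+ 2 + n)      ≡⟨ recurrence tv n ⟨
      v (+ 3 + n)                          ∎
      where open ≡-Reasoning

    agree-down : ∀ n → Agree (+ 1 + n) → Agree (+ 2 + n) → Agree (+ 3 + n) → Agree n
    agree-down n p q r = begin
      u n                                      ≡⟨ first-summand (recurrence tu n) ⟩
      u (+ 3 + n) - u (+ 1 + n) - u (+ 2 + n)  ≡⟨ cong₂ _-_ (cong₂ _-_ r p) q ⟩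
      v (+ 3 + n) - v (+ 1 + n) - v (+ 2 + n)  ≡⟨ first-summand (recurrence tv n) ⟨
      v n                                      ∎
      where
      open ≡-Reasoning
      first-summand : ∀ {a b c d} → d ≡ a + b + c → a ≡ d - b - c
      first-summand {a} {b} {c} refl = solve (a ∷ b ∷ c ∷ [])

  Tribonacci-unique : u (+ 0) ≡ v (+ 0) → u (+ 1) ≡ v (+ 1) → u (+ 2) ≡ v (+ 2) → ∀ n → u n ≡ v n
  Tribonacci-unique p₀ p₁ p₂ (+ m)    = forward m
    where
    forward : ∀ m → Agree (+ m)
    forward 0                   = p₀
    forward 1                   = p₁
    forward 2                   = p₂
    forward (suc (suc (suc m))) = agree-up (+ m) (forward m) (forward (suc m)) (forward (suc (suc m)))
  Tribonacci-unique p₀ p₁ p₂ -[1+ m ] = backward m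
    where
    backward : ∀ m → Agree -[1+ m ]
    backward 0                   = agree-down -[1+ 0 ] p₀ p₁ p₂
    backward 1                   = agree-down -[1+ 1 ] (backward 0) p₀ p₁
    backward 2                   = agree-down -[1+ 2 ] (backward 1) (backward 0) p₀
    backward (suc (suc (suc m))) =
      agree-down -[1+ suc (suc (suc m)) ] (backward (suc (suc m))) (backward (suc m)) (backward m)

module _ {v : ℤ → ℤ} (tv : Tribonacci v) where

  Tribonacci-*ˡ : ∀ a → Tribonacci (λ n → a * v n)
  Tribonacci-*ˡ a = tribonacci λ n →
    trans (cong (a *_) (recurrence tv n)) (*-distribˡ-+₃ a (v n) (v (+ 1 + n)) (v (+ 2 + n)))
    where
    *-distribˡ-+₃ : ∀ a x y z → a * (x + y + z) ≡ a * x + a * y + a * z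
    *-distribˡ-+₃ = solve-∀

  Tribonacci-shiftˡ : ∀ r → Tribonacci (λ n → v (r + n))
  Tribonacci-shiftˡ r = tribonacci λ n → begin
    v (r + (+ 3 + n))                                  ≡⟨ cong v (+-comm-middle r (+ 3) n) ⟩
    v (+ 3 + (r + n))                                  ≡⟨ recurrence tv (r + n) ⟩
    v (r + n) + v (+ 1 + (r + n)) + v (+ 2 + (r + n))  ≡⟨ cong₂ (λ i j → v (r + n) + v i + v j)
                                                               (+-comm-middle r (+ 1) n)
                                                               (+-comm-middle r (+ 2) n) ⟨
    v (r + n) + v (r + (+ 1 + n)) + v (r + (+ 2 + n))  ∎
    where
    open ≡-Reasoning
    +-comm-middle : ∀ i j k → i + (j + k) ≡ j + (i + k)
    +-comm-middle = solve-∀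

  Tribonacci-shiftʳ : ∀ k → Tribonacci (λ n → v (n + k))
  Tribonacci-shiftʳ k = tribonacci λ n → begin
    v (+ 3 + n + k)                                    ≡⟨ cong v (+-assoc (+ 3) n k) ⟩
    v (+ 3 + (n + k))                                  ≡⟨ recurrence tv (n + k) ⟩
    v (n + k) + v (+ 1 + (n + k)) + v (+ 2 + (n + k))  ≡⟨ cong₂ (λ i j → v (n + k) + v i + v j)
                                                               (+-assoc (+ 1) n k)
                                                               (+-assoc (+ 2) n k) ⟨
    v (n + k) + v (+ 1 + n + k) + v (+ 2 + n + k)      ∎
    where open ≡-Reasoning

-- u is the value at offset k of the Tribonacci-recurrent sequence taking the values x, y, z
-- at offsets 0, 1, 2.
Window : ℤ → ℤ → ℤ → ℤ → ℤ → Set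
Window x y z k u = u ≡ x * T (k - + 2) + y * T k + (z - y) * T (k - + 1)

window-expansion : ∀ {v} → Tribonacci v → ∀ r s → Window (v r) (v (r + + 1)) (v (r + + 2)) s (v (r + s))
window-expansion {v} tv r = Tribonacci-unique (Tribonacci-shiftˡ tv r) combination
  (trans (cong v (+-identityʳ r)) (value-at-0 x y z)) (value-at-1 x y z) (value-at-2 x y z)
  where
  x y z : ℤ
  x = v r
  y = v (r + + 1)
  z = v (r + + 2)
  combination : Tribonacci (λ s → x * T (s - + 2) + y * T s + (z - y) * T (s - + 1))
  combination = Tribonacci-+ (Tribonacci-+ (Tribonacci-*ˡ (Tribonacci-shiftʳ T-tribonacci (- + 2)) x)
                                           (Tribonacci-*ˡ T-tribonacci y))
                             (Tribonacci-*ˡ (Tribonacci-shiftʳ T-tribonacci (- + 1)) (z - y))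
  value-at-0 : ∀ a b c → a ≡ a * + 1 + b * + 0 + (c - b) * + 0
  value-at-0 = solve-∀
  value-at-1 : ∀ a b c → b ≡ a * + 0 + b * + 1 + (c - b) * + 0
  value-at-1 = solve-∀
  value-at-2 : ∀ a b c → c ≡ a * + 0 + b * + 1 + (c - b) * + 1
  value-at-2 = solve-∀

Identities : (W[r+s] W[r-7] W[r-5] W[r-4] W[r-3] W[r-2] W[r-1] W[r] W[r+1] W[r+2] W[r+3] W[r+4]
              T[s-4] T[s-1] T[s] T[s+1] T[s+2] T[s+4] : ℤ) → Set
Identities W[r+s] W[r-7] W[r-5] W[r-4] W[r-3] W[r-2] W[r-1] W[r] W[r+1] W[r+2] W[r+3] W[r+4]
           T[s-4] T[s-1] T[s] T[s+1] T[s+2] T[s+4] =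
    (+ 16 * (W[r+s] * W[r+s]) ≡
        - ((T[s] + T[s+4]) * (- T[s+4] + + 2 * T[s-1] + + 7 * T[s])) * (W[r] * W[r])
      + + 4 * T[s-1] * T[s] * (W[r-7] * W[r-7])
      + + 2 * T[s-1] * (- T[s+4] - + 9 * T[s] + + 2 * T[s-1]) * (W[r-4] * W[r-4])
      - + 2 * T[s] * (T[s+4] - + 7 * T[s] + + 2 * T[s-1]) * (W[r-3] * W[r-3])
      + + 8 * T[s-1] * (T[s] + T[s+4]) * (W[r-1] * W[r-1])
      + + 2 * T[s] * (T[s] + T[s+4]) * (W[r+1] * W[r+1]))
    × (+ 16 * (W[r+s] * W[r+s]) ≡
        + 4 * (+ 2 * T[s] - T[s+1]) * (+ 7 * T[s] - T[s-4] - + 4 * T[s+1]) * (W[r] * W[r])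
      + + 4 * T[s-4] * (+ 2 * T[s] - T[s+1]) * (W[r-4] * W[r-4])
      - + 4 * T[s-4] * (- T[s-4] - + 4 * T[s+1] + + 9 * T[s]) * (W[r-1] * W[r-1])
      + + 16 * T[s-4] * T[s] * (W[r+2] * W[r+2])
      - + 4 * T[s] * (+ 7 * T[s] + T[s-4] - + 4 * T[s+1]) * (W[r+3] * W[r+3])
      + + 4 * T[s] * (+ 2 * T[s] - T[s+1]) * (W[r+4] * W[r+4]))
    × (+ 4 * (W[r+s] * W[r+s]) ≡
        - (+ 2 * (- T[s+1] + T[s]) * (+ 2 * T[s+2] - T[s-1])) * (W[r] * W[r])
      - T[s-1] * T[s] * (W[r-5] * W[r-5])
      + + 2 * T[s-1] * (- T[s+1] + T[s]) * (W[r-4] * W[r-4])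
      + + 2 * T[s] * (- T[s+1] + T[s]) * (W[r-3] * W[r-3])
      + + 4 * T[s-1] * T[s] * (W[r-2] * W[r-2])
      + + 2 * T[s-1] * (+ 2 * T[s-1] + + 4 * T[s+1] - + 3 * T[s]) * (W[r-1] * W[r-1])
      + + 2 * T[s] * (T[s] + T[s+1]) * (W[r+1] * W[r+1])
      - T[s-1] * T[s] * (W[r+3] * W[r+3])
      + + 4 * T[s-1] * T[s] * (W[r+2] * W[r+2]))

window-identities :
  ∀ x y z a b c {W[r+s] W[r-7] W[r-5] W[r-4] W[r-3] W[r-2] W[r-1] W[r+3] W[r+4] T[s-4] T[s-2] T[s-1] T[s+4]} →
  W[r+s] ≡ x * T[s-2] + y * a + (z - y) * T[s-1] →
  Window x y z (- + 7) W[r-7] → Window x y z (- + 5) W[r-5] → Window x y z (- + 4) W[r-4] →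
  Window x y z (- + 3) W[r-3] → Window x y z (- + 2) W[r-2] → Window x y z (- + 1) W[r-1] →
  Window x y z (+ 3) W[r+3] → Window x y z (+ 4) W[r+4] →
  Window a b c (- + 4) T[s-4] → Window a b c (- + 2) T[s-2] → Window a b c (- + 1) T[s-1] →
  Window a b c (+ 4) T[s+4] →
  Identities W[r+s] W[r-7] W[r-5] W[r-4] W[r-3] W[r-2] W[r-1] x y z W[r+3] W[r+4] T[s-4] T[s-1] a b c T[s+4]
window-identities x y z a b c refl refl refl refl refl refl refl refl refl refl refl refl refl =
  solve (x ∷ y ∷ z ∷ a ∷ b ∷ c ∷ []) ,
  solve (x ∷ y ∷ z ∷ a ∷ b ∷ c ∷ []) ,
  solve (x ∷ y ∷ z ∷ a ∷ b ∷ c ∷ [])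

theorem7 : (W₀ W₁ W₂ : ℤ) → ¬ (W₀ ≡ + 0 × W₁ ≡ + 0 × W₂ ≡ + 0) → (r s : ℤ) →
  let Wr = λ (k : ℤ) → W W₀ W₁ W₂ k * W W₀ W₁ W₂ k in
  (+ 16 * Wr (r + s) ≡
      - ((T s + T (s + + 4)) * (- T (s + + 4) + + 2 * T (s - + 1) + + 7 * T s)) * Wr r
    + + 4 * T (s - + 1) * T s * Wr (r - + 7)
    + + 2 * T (s - + 1) * (- T (s + + 4) - + 9 * T s + + 2 * T (s - + 1)) * Wr (r - + 4)
    - + 2 * T s * (T (s + + 4) - + 7 * T s + + 2 * T (s - + 1)) * Wr (r - + 3)
    + + 8 * T (s - + 1) * (T s + T (s + + 4)) * Wr (r - + 1)
    + + 2 * T s * (T s + T (s + + 4)) * Wr (r + + 1))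
  × (+ 16 * Wr (r + s) ≡
      + 4 * (+ 2 * T s - T (s + + 1)) * (+ 7 * T s - T (s - + 4) - + 4 * T (s + + 1)) * Wr r
    + + 4 * T (s - + 4) * (+ 2 * T s - T (s + + 1)) * Wr (r - + 4)
    - + 4 * T (s - + 4) * (- T (s - + 4) - + 4 * T (s + + 1) + + 9 * T s) * Wr (r - + 1)
    + + 16 * T (s - + 4) * T s * Wr (r + + 2)
    - + 4 * T s * (+ 7 * T s + T (s - + 4) - + 4 * T (s + + 1)) * Wr (r + + 3)
    + + 4 * T s * (+ 2 * T s - T (s + + 1)) * Wr (r + + 4))
  × (+ 4 * Wr (r + s) ≡
      - (+ 2 * (- T (s + + 1) + T s) * (+ 2 * T (s + + 2) - T (s - + 1))) * Wr r
    - T (s - + 1) * T s * Wr (r - + 5)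
    + + 2 * T (s - + 1) * (- T (s + + 1) + T s) * Wr (r - + 4)
    + + 2 * T s * (- T (s + + 1) + T s) * Wr (r - + 3)
    + + 4 * T (s - + 1) * T s * Wr (r - + 2)
    + + 2 * T (s - + 1) * (+ 2 * T (s - + 1) + + 4 * T (s + + 1) - + 3 * T s) * Wr (r - + 1)
    + + 2 * T s * (T s + T (s + + 1)) * Wr (r + + 1)
    - T (s - + 1) * T s * Wr (r + + 3)
    + + 4 * T (s - + 1) * T s * Wr (r + + 2))
theorem7 w₀ w₁ w₂ _ r s =
  window-identities (W′ r) (W′ (r + + 1)) (W′ (r + + 2)) (T s) (T (s + + 1)) (T (s + + 2))
    (w s) (w (- + 7)) (w (- + 5)) (w (- + 4)) (w (- + 3)) (w (- + 2)) (w (- + 1)) (w (+ 3)) (w (+ 4))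
    (t (- + 4)) (t (- + 2)) (t (- + 1)) (t (+ 4))
  where
  W′ : ℤ → ℤ
  W′ = W w₀ w₁ w₂
  w : ∀ k → Window (W′ r) (W′ (r + + 1)) (W′ (r + + 2)) k (W′ (r + k))
  w = window-expansion (W-tribonacci w₀ w₁ w₂) r
  t : ∀ k → Window (T s) (T (s + + 1)) (T (s + + 2)) k (T (s + k))
  t = window-expansion T-tribonacci s
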